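{- Let $(W,S)$ be a finite Coxeter system, $i\ne j$ with $m:=m_{ij}>3$, $\mathsf Q,\mathsf Q'\in S^*$, $\pi\in W$, and assume that conditions $(A_3)$ and $(B_3)$ hold. Then $\Delta_1$ contains no $1$-simplex of the form $\{\mathsf f_k,\mathsf f_l\}$ with $2\le k\le m-1$ (i.e. $\mathsf f_k$ internal), $1\le l\le m$, $l\ne k$ and $|k-l|\neq1$.
   Context: $(W,S)$ is a finite Coxeter system, $m_{ij}$ the order of $s_is_j$; $S^*$ the set of words in the alphabet $S$ (letter $\mathsf s$ for $s$); a word is a reduced expression of the product of its letters if its length equals the Coxeter length of that product; $\mathsf u$ contains $\mathsf v$ if $\mathsf v$ is obtained from $\mathsf u$ by deleting letters. For $\mathsf U\in S^*$, $\rho\in W$, the subword complex $\Delta(\mathsf U;\rho)$ has vertex set the positions of $\mathsf U$ (distinct positions are distinct vertices) and faces the sets $I$ of positions such that the letters at positions outside $I$ form a word containing a reduced expression of $\rho$. For $0\le k\le m$, $\mathsf w^k_{i,j}$ is the alternating word $\mathsf s_i\mathsf s_j\mathsf s_i\cdots$ of length $m-k$, $\mathsf w^k_{j,i}$ the one starting with $\mathsf s_j$; $\mathsf Q^k_1=\mathsf Q\mathsf w^k_{i,j}\mathsf Q'$, $\mathsf Q^k_2=\mathsf Q\mathsf w^k_{j,i}\mathsf Q'$; $\mathsf f_l$, $1\le l\le m$, is the position in $\mathsf Q^0_1$ of the $l$-th letter of the factor $\mathsf w^0_{i,j}$; $\Delta_1=\Delta(\mathsf Q^0_1;\pi)$.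 Condition $(A_3)$: $\mathsf Q^3_1$ contains no reduced expression of $\pi$; $(B_3)$: $\mathsf Q^3_2$ contains no reduced expression of $\pi$. -}

module Defs where

open import Data.Nat using (ℕ; zero; suc; _+_; _∸_; _≤_; _<_)
open import Data.Fin using (Fin)
open import Data.Fin.Subset using (Subset)
open import Data.Vec using (Vec; []; _∷_)
open import Data.Bool using (Bool; true; false)
open import Data.List using (List; []; _∷_; _++_; length)
open import Data.List.Membership.Propositional using (_∈_)
open import Data.List.Relation.Binary.Sublist.Propositional using (_⊆_)
open import Data.Product using (Σ; _×_; ∃)
open import Relation.Binary.PropositionalEquality using (_≡_; _≢_)
open import Relation.Binary.Construct.Closure.Equivalence using (EqClosure)
open import Relation.Nullary using (¬_)

-- A Coxeter matrix on the generator set S = Fin n.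
-- (Entries are natural numbers: in a finite Coxeter system all m_ij are finite.)
record IsCoxeterMatrix (n : ℕ) (M : Fin n → Fin n → ℕ) : Set where
  field
    diag : ∀ i → M i i ≡ 1
    symm : ∀ i j → M i j ≡ M j i
    offdiag : ∀ i j → i ≢ j → 2 ≤ M i j

Word : ℕ → Set
Word n = List (Fin n)

alt : ∀ {n} → Fin n → Fin n → ℕ → Word n
alt s t zero = []
alt s t (suc k) = s ∷ alt t s k

data CoxStep {n : ℕ} (M : Fin n → Fin n → ℕ) : Word n → Word n → Set where
  cancel : ∀ (u v : Word n) (s : Fin n) → CoxStep M (u ++ s ∷ s ∷ v) (u ++ v)
  braid  : ∀ (u v : Word n) (s t : Fin n) →
           CoxStep M (u ++ alt s t (M s t) ++ v) (u ++ alt t s (M s t) ++ v)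

-- Two words represent the same element of the Coxeter group
-- W = < S | s^2 = 1, (st)^{m_st} = 1 >  (equivalence closure of the steps).
_≈[_]_ : ∀ {n} → Word n → (Fin n → Fin n → ℕ) → Word n → Set
u ≈[ M ] v = EqClosure (CoxStep M) u v

FiniteCoxeterGroup : ∀ {n} → (Fin n → Fin n → ℕ) → Set
FiniteCoxeterGroup {n} M = Σ (List (Word n)) λ L → ∀ (u : Word n) → ∃ λ v → v ∈ L × u ≈[ M ] v

IsReducedExprOf : ∀ {n} → (Fin n → Fin n → ℕ) → Word n → Word n → Set
IsReducedExprOf M v p = v ≈[ M ] p × (∀ u → u ≈[ M ] p → length v ≤ length u)

ContainsReducedExpr : ∀ {n} → (Fin n → Fin n → ℕ) → Word n → Word n → Set
ContainsReducedExpr M u p = ∃ λ v → v ⊆ u × IsReducedExprOf M v p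

outside : ∀ {n} (U : Word n) → Subset (length U) → Word n
outside [] [] = []
outside (x ∷ U) (true ∷ I) = outside U I
outside (x ∷ U) (false ∷ I) = x ∷ outside U I

-- I is a face of the subword complex Δ(U; ρ) (ρ represented by the word p).
IsFace : ∀ {n} → (Fin n → Fin n → ℕ) → (U : Word n) → Word n → Subset (length U) → Set
IsFace M U p I = ContainsReducedExpr M (outside U I) p

wk : ∀ {n} → (Fin n → Fin n → ℕ) → ℕ → Fin n → Fin n → Word n
wk M k i j = alt i j (M i j ∸ k)

-- Deleting the internal letter f_k of the factor w⁰ = s_i s_j s_i ⋯ (length m) brings its two
-- neighbours, which carry the same letter, next to each other; deleting also f_l (not a
-- neighbour of f_k) leaves a word of length m - 2 containing a square cc.  A reduced
-- expression has no factor ss, so its part inside this factor uses at most one of the two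
-- c's and has length at most m - 3; being square-free over {s_i, s_j} it is alternating,
-- hence contained in w³_{i,j} or w³_{j,i}.  The complement of {f_k, f_l} would then give a
-- reduced expression of π inside Q³₁ or Q³₂, contradicting (A₃) or (B₃).
module Submission where

open import Defs
open import Data.Nat using (ℕ; zero; suc; _+_; _∸_; _≤_; _<_; ∣_-_∣; _≡ᵇ_; z≤n; s≤s)
open import Data.Nat.Properties
  using (≤-refl; ≤-trans; n≤1+n; 1+n≰n; m≤n⇒m≤1+n; m<n⇒m<1+n; +-comm; m+n≤o⇒m≤o∸n; m≤o∸n⇒m+n≤o; +-cancelˡ-≤;
         ≡ᵇ⇒≡; ≡⇒≡ᵇ; ∣-∣-comm)
open import Data.Fin as Fin using (Fin; toℕ)
open import Data.Fin.Subset using (Subset; ⁅_⁆; _∪_)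
open import Data.Bool using (Bool; true; false; T; _∨_; if_then_else_)
open import Data.Bool.Properties using (T-∨)
open import Data.Vec as Vec using (lookup)
open import Data.Vec.Properties using (lookup-zipWith; lookup-replicate)
open import Data.List using (List; []; _∷_; _++_; length)
open import Data.List.Properties using (++-assoc; length-++)
open import Data.List.Relation.Binary.Sublist.Propositional
  using (_⊆_; []; _∷_; _∷ʳ_; ⊆-trans; minimum)
  renaming (lookup to ⊆-lookup)
open import Data.List.Relation.Binary.Sublist.Propositional.Properties
  using (++⁺; length-mono-≤)
open import Data.List.Relation.Unary.All as All using (All; []; _∷_)
open import Data.List.Relation.Unary.All.Properties using (anti-mono)
open import Data.Product using (∃; ∃₂; _×_; _,_)
open import Data.Sum using (_⊎_; inj₁; inj₂; [_,_]′; swap)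
open import Data.Empty using (⊥-elim)
open import Function using (_∘_; Equivalence)
open import Relation.Binary.PropositionalEquality
  using (_≡_; _≢_; refl; sym; trans; cong; cong₂; subst; subst₂; _≗_; module ≡-Reasoning)
open import Relation.Binary.Construct.Closure.ReflexiveTransitive using (_◅_)
open import Relation.Binary.Construct.Closure.Symmetric using (bwd)
open import Relation.Nullary using (¬_)

module _ {A : Set} where

  ⊆-++-split : ∀ (xs ys : List A) {v} → v ⊆ xs ++ ys →
               ∃₂ λ v₁ v₂ → v ≡ v₁ ++ v₂ × v₁ ⊆ xs × v₂ ⊆ ys
  ⊆-++-split [] ys τ = [] , _ , refl , [] , τ
  ⊆-++-split (x ∷ xs) ys (.x ∷ʳ τ) with ⊆-++-split xs ys τ
  ... | v₁ , v₂ , refl , τ₁ , τ₂ = v₁ , v₂ , refl , x ∷ʳ τ₁ , τ₂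
  ⊆-++-split (x ∷ xs) ys (refl ∷ τ) with ⊆-++-split xs ys τ
  ... | v₁ , v₂ , refl , τ₁ , τ₂ = x ∷ v₁ , v₂ , refl , refl ∷ τ₁ , τ₂

  ⊆-++-split³ : ∀ (xs ys zs : List A) {v} → v ⊆ xs ++ ys ++ zs →
                ∃₂ λ v₁ v₂ → ∃ λ v₃ → v ≡ v₁ ++ v₂ ++ v₃ × v₁ ⊆ xs × v₂ ⊆ ys × v₃ ⊆ zs
  ⊆-++-split³ xs ys zs τ with ⊆-++-split xs (ys ++ zs) τ
  ... | v₁ , w , refl , τ₁ , τ′ with ⊆-++-split ys zs τ′
  ... | v₂ , v₃ , refl , τ₂ , τ₃ = v₁ , v₂ , v₃ , refl , τ₁ , τ₂ , τ₃

  -- The letters at positions p (counted from 0) with T (f p) are removed.  Positions are a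
  -- predicate on ℕ rather than a Subset (Fin (length xs)), so that deletion splits along _++_.
  deletePositions : (ℕ → Bool) → List A → List A
  deletePositions f [] = []
  deletePositions f (x ∷ xs) =
    if f 0 then deletePositions (f ∘ suc) xs else x ∷ deletePositions (f ∘ suc) xs

  deletePositions-⊆ : ∀ f xs → deletePositions f xs ⊆ xs
  deletePositions-⊆ f [] = []
  deletePositions-⊆ f (x ∷ xs) with f 0
  ... | true  = x ∷ʳ deletePositions-⊆ (f ∘ suc) xs
  ... | false = refl ∷ deletePositions-⊆ (f ∘ suc) xs

  deletePositions-cong : ∀ {f g} → f ≗ g → ∀ xs → deletePositions f xs ≡ deletePositions g xs
  deletePositions-cong f≗g [] = refl
  deletePositions-cong {f} {g} f≗g (x ∷ xs) rewrite f≗g 0 with g 0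
  ... | true  = deletePositions-cong (f≗g ∘ suc) xs
  ... | false = cong (x ∷_) (deletePositions-cong (f≗g ∘ suc) xs)

  deletePositions-++ : ∀ f xs ys →
    deletePositions f (xs ++ ys) ≡ deletePositions f xs ++ deletePositions (λ p → f (length xs + p)) ys
  deletePositions-++ f [] ys = refl
  deletePositions-++ f (x ∷ xs) ys with f 0
  ... | true  = deletePositions-++ (f ∘ suc) xs ys
  ... | false = cong (x ∷_) (deletePositions-++ (f ∘ suc) xs ys)

  length-deletePositions< : ∀ f {p} xs → T (f p) → p < length xs →
                            length (deletePositions f xs) < length xs
  length-deletePositions< f {zero} (x ∷ xs) fp _ with f 0
  ... | true = s≤s (length-mono-≤ (deletePositions-⊆ (f ∘ suc) xs))
  length-deletePositions< f {suc p} (x ∷ xs) fp (s≤s p<) with f 0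
  ... | true  = m<n⇒m<1+n (length-deletePositions< (f ∘ suc) xs fp p<)
  ... | false = s≤s (length-deletePositions< (f ∘ suc) xs fp p<)

  length-deletePositions<₂ : ∀ f {p q} xs → T (f p) → T (f q) → p ≢ q → p < length xs → q < length xs →
                             2 + length (deletePositions f xs) ≤ length xs
  length-deletePositions<₂ f {zero} {zero} xs _ _ p≢q _ _ = ⊥-elim (p≢q refl)
  length-deletePositions<₂ f {zero} {suc q} (x ∷ xs) fp fq _ _ (s≤s q<) with f 0
  ... | true = s≤s (length-deletePositions< (f ∘ suc) xs fq q<)
  length-deletePositions<₂ f {suc p} {zero} (x ∷ xs) fp fq _ (s≤s p<) _ with f 0
  ... | true = s≤s (length-deletePositions< (f ∘ suc) xs fp p<)
  length-deletePositions<₂ f {suc p} {suc q} (x ∷ xs) fp fq p≢q (s≤s p<) (s≤s q<) with f 0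
  ... | true  = m≤n⇒m≤1+n (length-deletePositions<₂ (f ∘ suc) xs fp fq (p≢q ∘ cong suc) p< q<)
  ... | false = s≤s (length-deletePositions<₂ (f ∘ suc) xs fp fq (p≢q ∘ cong suc) p< q<)

  HasSquare : List A → Set
  HasSquare u = ∃₂ λ X Y → ∃ λ s → u ≡ X ++ s ∷ s ∷ Y

  SquareFree : List A → Set
  SquareFree w = ¬ HasSquare w

  squareFree-∷⁻ : ∀ {x w} → SquareFree (x ∷ w) → SquareFree w
  squareFree-∷⁻ sf (X , Y , s , refl) = sf (_ ∷ X , Y , s , refl)

  squareFree-infix : ∀ u w v → SquareFree (u ++ w ++ v) → SquareFree w
  squareFree-infix u w v sf (X , Y , s , refl) =
    sf (u ++ X , Y ++ v , s , trans (cong (u ++_) (++-assoc X (s ∷ s ∷ Y) v)) (sym (++-assoc u X _)))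

  length-squareFree-⊆-square : ∀ X x Y {w} → SquareFree w → w ⊆ X ++ x ∷ x ∷ Y →
                               length w < length (X ++ x ∷ x ∷ Y)
  length-squareFree-⊆-square [] x Y sf (.x ∷ʳ τ) = s≤s (length-mono-≤ τ)
  length-squareFree-⊆-square [] x Y sf (refl ∷ .x ∷ʳ τ) = s≤s (s≤s (length-mono-≤ τ))
  length-squareFree-⊆-square [] x Y sf (refl ∷ refl ∷ τ) = ⊥-elim (sf ([] , _ , x , refl))
  length-squareFree-⊆-square (a ∷ X) x Y sf (.a ∷ʳ τ) =
    m<n⇒m<1+n (length-squareFree-⊆-square X x Y sf τ)
  length-squareFree-⊆-square (a ∷ X) x Y sf (refl ∷ τ) =
    s≤s (length-squareFree-⊆-square X x Y (squareFree-∷⁻ sf) τ)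

  length-squareFree-⊆-hasSquare : ∀ {w u} → SquareFree w → HasSquare u → w ⊆ u → length w < length u
  length-squareFree-⊆-hasSquare sf (X , Y , s , refl) = length-squareFree-⊆-square X s Y sf

isEither : ℕ → ℕ → ℕ → Bool
isEither a b p = (p ≡ᵇ a) ∨ (p ≡ᵇ b)

isEither-left : ∀ a b → T (isEither a b a)
isEither-left a b = Equivalence.from T-∨ (inj₁ (≡⇒≡ᵇ a a refl))

isEither-right : ∀ a b → T (isEither a b b)
isEither-right a b = Equivalence.from T-∨ (inj₂ (≡⇒≡ᵇ b b refl))

isEither-other : ∀ {a b p} → p ≢ a → p ≢ b → ¬ T (isEither a b p)
isEither-other {a} {b} {p} p≢a p≢b =
  [ p≢a ∘ ≡ᵇ⇒≡ p a , p≢b ∘ ≡ᵇ⇒≡ p b ]′ ∘ Equivalence.to T-∨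

isEither-+ : ∀ c a b p → isEither (c + a) (c + b) (c + p) ≡ isEither a b p
isEither-+ zero    = λ a b p → refl
isEither-+ (suc c) = isEither-+ c

lookup-⁅⁆ : ∀ {N} (x q : Fin N) → lookup ⁅ x ⁆ q ≡ (toℕ q ≡ᵇ toℕ x)
lookup-⁅⁆ Fin.zero    Fin.zero    = refl
lookup-⁅⁆ Fin.zero    (Fin.suc q) = lookup-replicate q false
lookup-⁅⁆ (Fin.suc x) Fin.zero    = refl
lookup-⁅⁆ (Fin.suc x) (Fin.suc q) = lookup-⁅⁆ x q

outside-≡-deletePositions : ∀ {n} (U : Word n) (I : Subset (length U)) (f : ℕ → Bool) →
  (∀ q → lookup I q ≡ f (toℕ q)) → outside U I ≡ deletePositions f U
outside-≡-deletePositions [] Vec.[] f I≗f = refl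
outside-≡-deletePositions (x ∷ U) (b Vec.∷ I) f I≗f with f 0 | I≗f Fin.zero
... | true  | refl = outside-≡-deletePositions U I (f ∘ suc) (I≗f ∘ Fin.suc)
... | false | refl = cong (x ∷_) (outside-≡-deletePositions U I (f ∘ suc) (I≗f ∘ Fin.suc))

outside-pair-in-factor : ∀ {n} (Q W Q' : Word n) (fk fl : Fin (length (Q ++ W ++ Q'))) {a b} →
  toℕ fk ≡ length Q + a → toℕ fl ≡ length Q + b →
  ∃₂ λ Q° Q'° → Q° ⊆ Q × Q'° ⊆ Q' ×
    outside (Q ++ W ++ Q') (⁅ fk ⁆ ∪ ⁅ fl ⁆) ≡ Q° ++ deletePositions (isEither a b) W ++ Q'°
outside-pair-in-factor Q W Q' fk fl {a} {b} fk≡ fl≡ =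
  _ , _ , deletePositions-⊆ f Q , deletePositions-⊆ f″ Q' , (begin
    outside (Q ++ W ++ Q') (⁅ fk ⁆ ∪ ⁅ fl ⁆)
      ≡⟨ outside-≡-deletePositions (Q ++ W ++ Q') _ f lookup-pair ⟩
    deletePositions f (Q ++ W ++ Q')
      ≡⟨ deletePositions-++ f Q (W ++ Q') ⟩
    deletePositions f Q ++ deletePositions f′ (W ++ Q')
      ≡⟨ cong (deletePositions f Q ++_) (deletePositions-++ f′ W Q') ⟩
    deletePositions f Q ++ deletePositions f′ W ++ deletePositions f″ Q'
      ≡⟨ cong (λ D → deletePositions f Q ++ D ++ deletePositions f″ Q')
              (deletePositions-cong (isEither-+ (length Q) a b) W) ⟩
    deletePositions f Q ++ deletePositions (isEither a b) W ++ deletePositions f″ Q' ∎)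
  where
  open ≡-Reasoning
  f : ℕ → Bool
  f = isEither (length Q + a) (length Q + b)
  f′ : ℕ → Bool
  f′ p = f (length Q + p)
  f″ : ℕ → Bool
  f″ p = f′ (length W + p)
  lookup-pair : ∀ q → lookup (⁅ fk ⁆ ∪ ⁅ fl ⁆) q ≡ f (toℕ q)
  lookup-pair q = begin
    lookup (⁅ fk ⁆ ∪ ⁅ fl ⁆) q              ≡⟨ lookup-zipWith _∨_ q ⁅ fk ⁆ ⁅ fl ⁆ ⟩
    lookup ⁅ fk ⁆ q ∨ lookup ⁅ fl ⁆ q        ≡⟨ cong₂ _∨_ (lookup-⁅⁆ fk q) (lookup-⁅⁆ fl q) ⟩
    (toℕ q ≡ᵇ toℕ fk) ∨ (toℕ q ≡ᵇ toℕ fl)  ≡⟨ cong₂ (λ x y → isEither x y (toℕ q)) fk≡ fl≡ ⟩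
    f (toℕ q)                               ∎

module _ {n : ℕ} where

  Over : Fin n → Fin n → Word n → Set
  Over x y = All (λ z → z ≡ x ⊎ z ≡ y)

  alt-over : ∀ (x y : Fin n) t → Over x y (alt x y t)
  alt-over x y zero    = []
  alt-over x y (suc t) = inj₁ refl ∷ All.map swap (alt-over y x t)

  length-alt : ∀ (x y : Fin n) t → length (alt x y t) ≡ t
  length-alt x y zero    = refl
  length-alt x y (suc t) = cong suc (length-alt y x t)

  alt-mono : ∀ (x y : Fin n) {a b} → a ≤ b → alt x y a ⊆ alt x y b
  alt-mono x y {b = b} z≤n = minimum (alt x y b)
  alt-mono x y (s≤s a≤b) = refl ∷ alt-mono y x a≤b

  squareFree-over⇒alt : ∀ x y w → SquareFree (x ∷ w) → Over x y w → x ∷ w ≡ alt x y (suc (length w))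
  squareFree-over⇒alt x y []      sf []                = refl
  squareFree-over⇒alt x y (z ∷ w) sf (inj₁ refl ∷ ow) = ⊥-elim (sf ([] , w , x , refl))
  squareFree-over⇒alt x y (z ∷ w) sf (inj₂ refl ∷ ow) =
    cong (x ∷_) (squareFree-over⇒alt y x w (squareFree-∷⁻ sf) (All.map swap ow))

  squareFree-⊆-alt : ∀ (x y : Fin n) {w N} → SquareFree w → Over x y w → length w ≤ N →
                     w ⊆ alt x y N ⊎ w ⊆ alt y x N
  squareFree-⊆-alt x y {[]} {N} sf ow w≤N = inj₁ (minimum (alt x y N))
  squareFree-⊆-alt x y {z ∷ w} {N} sf (inj₁ refl ∷ ow) w≤N =
    inj₁ (subst (_⊆ alt x y N) (sym (squareFree-over⇒alt x y w sf ow)) (alt-mono x y w≤N))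
  squareFree-⊆-alt x y {z ∷ w} {N} sf (inj₂ refl ∷ ow) w≤N =
    inj₂ (subst (_⊆ alt y x N) (sym (squareFree-over⇒alt y x w sf (All.map swap ow))) (alt-mono y x w≤N))

  -- The neighbours of position 1 + a in an alternating word carry the same letter.
  deletePositions-alt-hasSquare : ∀ f (x y : Fin n) {a m} → 3 + a ≤ m →
    ¬ T (f a) → T (f (1 + a)) → ¬ T (f (2 + a)) → HasSquare (deletePositions f (alt x y m))
  deletePositions-alt-hasSquare f x y {zero} (s≤s (s≤s (s≤s _))) ¬f₀ f₁ ¬f₂ with f 0 | f 1 | f 2
  ... | true  | _     | _     = ⊥-elim (¬f₀ _)
  ... | false | false | _     = ⊥-elim f₁
  ... | false | true  | true  = ⊥-elim (¬f₂ _)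
  ... | false | true  | false = [] , _ , x , refl
  deletePositions-alt-hasSquare f x y {suc a} (s≤s a<m) ¬f₀ f₁ ¬f₂
    with deletePositions-alt-hasSquare (f ∘ suc) y x a<m ¬f₀ f₁ ¬f₂ | f 0
  ... | X , Y , s , eq | true  = X , Y , s , eq
  ... | X , Y , s , eq | false = x ∷ X , Y , s , cong (x ∷_) eq

  squareFree-⊆-alt-deletePair : ∀ (x y : Fin n) {m a b w} → 3 + a ≤ m → b < m →
    b ≢ a → b ≢ 1 + a → b ≢ 2 + a →
    SquareFree w → w ⊆ deletePositions (isEither (1 + a) b) (alt x y m) →
    w ⊆ alt x y (m ∸ 3) ⊎ w ⊆ alt y x (m ∸ 3)
  squareFree-⊆-alt-deletePair x y {m} {a} {b} {w} a<m b<m b≢a b≢1+a b≢2+a sf w⊆D =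
    squareFree-⊆-alt x y sf (anti-mono (⊆-lookup (⊆-trans w⊆D (deletePositions-⊆ f _))) (alt-over x y m))
      (m+n≤o⇒m≤o∸n (length w) (subst (_≤ m) (+-comm 3 (length w)) 3+w≤m))
    where
    f : ℕ → Bool
    f = isEither (1 + a) b
    D : Word n
    D = deletePositions f (alt x y m)
    within : ∀ {p} → p < m → p < length (alt x y m)
    within = subst (_ <_) (sym (length-alt x y m))
    w<D : length w < length D
    w<D = length-squareFree-⊆-hasSquare sf
      (deletePositions-alt-hasSquare f x y a<m
        (isEither-other {1 + a} {b} (λ ()) (b≢a ∘ sym))
        (isEither-left (1 + a) b)
        (isEither-other {1 + a} {b} (λ ()) (b≢2+a ∘ sym)))
      w⊆D
    2+D≤m : 2 + length D ≤ m
    2+D≤m = subst (2 + length D ≤_) (length-alt x y m)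
      (length-deletePositions<₂ f (alt x y m) (isEither-left (1 + a) b) (isEither-right (1 + a) b)
        (b≢1+a ∘ sym) (within (≤-trans (s≤s (m≤n⇒m≤1+n ≤-refl)) a<m)) (within b<m))
    3+w≤m : 3 + length w ≤ m
    3+w≤m = ≤-trans (s≤s (s≤s w<D)) 2+D≤m

reduced⇒squareFree : ∀ {n M} {v p : Word n} → IsReducedExprOf M v p → SquareFree v
reduced⇒squareFree (v≈p , minimal) (X , Y , s , refl) =
  1+n≰n (≤-trans (n≤1+n _) (+-cancelˡ-≤ (length X) _ _
    (subst₂ _≤_ (length-++ X) (length-++ X) (minimal (X ++ Y) (bwd (cancel X Y s) ◅ v≈p)))))

∣1+n-n∣≡1 : ∀ n → ∣ suc n - n ∣ ≡ 1
∣1+n-n∣≡1 zero    = refl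
∣1+n-n∣≡1 (suc n) = ∣1+n-n∣≡1 n

mainTheorem7 : ∀ (n : ℕ) (M : Fin n → Fin n → ℕ) → IsCoxeterMatrix n M → FiniteCoxeterGroup M →
    ∀ (i j : Fin n) → i ≢ j → 3 < M i j →
    ∀ (Q Q' π : Word n) →
    ¬ ContainsReducedExpr M (Q ++ wk M 3 i j ++ Q') π →
    ¬ ContainsReducedExpr M (Q ++ wk M 3 j i ++ Q') π →
    ∀ (k l : ℕ) → 2 ≤ k → k ≤ M i j ∸ 1 → 1 ≤ l → l ≤ M i j → l ≢ k → ∣ k - l ∣ ≢ 1 →
    ∀ (fk fl : Fin (length (Q ++ wk M 0 i j ++ Q'))) →
    toℕ fk ≡ length Q + (k ∸ 1) → toℕ fl ≡ length Q + (l ∸ 1) →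
    ¬ IsFace M (Q ++ wk M 0 i j ++ Q') π (⁅ fk ⁆ ∪ ⁅ fl ⁆)
mainTheorem7 n M cox _ i j _ 3<m Q Q' π ¬A ¬B _ _ (s≤s (s≤s {n = a} _)) k≤m∸1 (s≤s {n = b} _) l≤m
             l≢k ∣k-l∣≢1 fk fl fk≡ fl≡ (v , v⊆ , red)
  with outside-pair-in-factor Q (alt i j (M i j)) Q' fk fl fk≡ fl≡
... | Q° , Q'° , Q°⊆Q , Q'°⊆Q' , eq with ⊆-++-split³ Q° _ Q'° (subst (v ⊆_) eq v⊆)
... | v₁ , v₂ , v₃ , refl , v₁⊆ , v₂⊆ , v₃⊆ =
  [ (λ v₂⊆ij → ¬A (_ , embed v₂⊆ij , red)) , (λ v₂⊆ji → ¬B′ (_ , embed v₂⊆ji , red)) ]′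
    (squareFree-⊆-alt-deletePair i j 3+a≤m l≤m b≢a (l≢k ∘ cong suc) b≢2+a
      (squareFree-infix v₁ v₂ v₃ (reduced⇒squareFree red)) v₂⊆)
  where
  embed : ∀ {W} → v₂ ⊆ W → v₁ ++ v₂ ++ v₃ ⊆ Q ++ W ++ Q'
  embed v₂⊆W = ++⁺ (⊆-trans v₁⊆ Q°⊆Q) (++⁺ v₂⊆W (⊆-trans v₃⊆ Q'°⊆Q'))
  ¬B′ : ¬ ContainsReducedExpr M (Q ++ alt j i (M i j ∸ 3) ++ Q') π
  ¬B′ = ¬B ∘ subst (λ t → ContainsReducedExpr M (Q ++ alt j i (t ∸ 3) ++ Q') π) (IsCoxeterMatrix.symm cox i j)
  3+a≤m : 3 + a ≤ M i j
  3+a≤m = subst (_≤ M i j) (+-comm (2 + a) 1) (m≤o∸n⇒m+n≤o (2 + a) (≤-trans (s≤s z≤n) 3<m) k≤m∸1)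
  b≢a : b ≢ a
  b≢a b≡a = ∣k-l∣≢1 (subst (λ t → ∣ 2 + a - suc t ∣ ≡ 1) (sym b≡a) (∣1+n-n∣≡1 a))
  b≢2+a : b ≢ 2 + a
  b≢2+a b≡2+a = ∣k-l∣≢1 (subst (λ t → ∣ 2 + a - suc t ∣ ≡ 1) (sym b≡2+a)
    (trans (∣-∣-comm a (suc a)) (∣1+n-n∣≡1 a)))
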